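{- Let $n$ be a positive integer and let $T\subseteq[n]^3$ be a 2-comparable set of triples. Form the edge-labelled bipartite graph $\Gamma$ whose two vertex classes are disjoint copies $X$ and $Y$ of $[n]$, with an edge between $a\in X$ and $b\in Y$ labelled $c$ for each triple $(a,b,c)\in T$. Then $\Gamma$ contains no repeating cycle, i.e. there is no cycle $e_1,e_2,\dots,e_{2k}$ of edges in $\Gamma$ whose sequence of labels, read along the cycle, has the form $c_1c_2\dots c_kc_1c_2\dots c_k$.
   Context: $[n]=\{1,\dots,n\}$. For integer triples $a,b$, $a<_2b$ means $a_i<b_i$ for at least two indices $i$; a set of triples is 2-comparable if any two distinct elements $a,b$ satisfy $a<_2b$ or $b<_2a$. (In a 2-comparable set no two triples agree in their first two coordinates, so each edge of $\Gamma$ receives exactly one label.) -}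

module Defs where

open import Data.Nat using (ℕ; _≤_; _<_; _*_; _+_; suc)
open import Data.Product using (_×_; _,_; Σ; Σ-syntax)
open import Data.Sum using (_⊎_; inj₁; inj₂)
open import Data.Empty using (⊥)
open import Relation.Binary.PropositionalEquality using (_≡_; _≢_)

Triple : Set
Triple = ℕ × ℕ × ℕ

InCube : ℕ → Triple → Set
InCube n (a₁ , a₂ , a₃) = (1 ≤ a₁ × a₁ ≤ n) × (1 ≤ a₂ × a₂ ≤ n) × (1 ≤ a₃ × a₃ ≤ n)

_<₂_ : Triple → Triple → Set
(a₁ , a₂ , a₃) <₂ (b₁ , b₂ , b₃) =
  (a₁ < b₁ × a₂ < b₂) ⊎ (a₁ < b₁ × a₃ < b₃) ⊎ (a₂ < b₂ × a₃ < b₃)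

TripleSet : Set₁
TripleSet = Triple → Set

TwoComparable : TripleSet → Set
TwoComparable T = ∀ a b → T a → T b → a ≢ b → (a <₂ b) ⊎ (b <₂ a)

-- Vertices of Γ: inj₁ a is a ∈ X, inj₂ b is b ∈ Y (disjoint copies of [n]).
Vertex : Set
Vertex = ℕ ⊎ ℕ

Edge : TripleSet → Vertex → Vertex → ℕ → Set
Edge T (inj₁ a) (inj₂ b) c = T (a , b , c)
Edge T (inj₂ b) (inj₁ a) c = T (a , b , c)
Edge T (inj₁ _) (inj₁ _) c = ⊥
Edge T (inj₂ _) (inj₂ _) c = ⊥

-- A repeating cycle of length 2k (k ≥ 2, as cycles in the simple graph Γ have
-- length ≥ 4): vertices v 0, …, v (2k-1) pairwise distinct, indexed periodically
-- (v (i + 2k) = v i), edge e_(i+1) joins v i and v (i+1) with label l i, and the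
-- label sequence has the form c₁…c_k c₁…c_k, i.e. l (i + k) = l i.
RepeatingCycle : TripleSet → Set
RepeatingCycle T =
  Σ[ k ∈ ℕ ] (2 ≤ k ×
  Σ[ v ∈ (ℕ → Vertex) ] Σ[ l ∈ (ℕ → ℕ) ]
    ((∀ i → v (i + 2 * k) ≡ v i) ×
     (∀ i j → i < 2 * k → j < 2 * k → v i ≡ v j → i ≡ j) ×
     (∀ i → Edge T (v i) (v (suc i)) (l i)) ×
     (∀ i → l (i + k) ≡ l i)))

-- Along a repeating cycle e₀ e₁ … e₂ₖ₋₁, the edges eᵢ and eᵢ₊ₖ carry the same label and are
-- distinct, so by 2-comparability one is below the other in both vertex coordinates; call i
-- ahead or behind accordingly. Shifting by k swaps the roles, so some i is ahead while i + 1
-- is behind. Consecutive edges share a vertex, and 2-comparability forces their other two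
-- coordinates to move in the same direction; for the two pairs eᵢ eᵢ₊₁ and eᵢ₊ₖ eᵢ₊ₖ₊₁, whose
-- labels agree, this is incompatible with eᵢ ahead and eᵢ₊₁ behind.
module Submission where

open import Defs
open import Data.Nat using (ℕ; _≤_)
open import Relation.Nullary using (¬_)
open import Data.Nat using (zero; suc; _<_; _+_; _*_; _∸_; NonZero; >-nonZero; z<s; s≤s; _<?_)
open import Data.Nat.Properties
open import Data.Nat.DivMod using (_%_; _/_; m≡m%n+[m/n]*n; m%n<n)
open import Algebra.Properties.CommutativeSemigroup +-commutativeSemigroup using (xy∙z≈xz∙y)
open import Data.Product using (_×_; _,_; ∃-syntax)
open import Data.Sum using (_⊎_; inj₁; inj₂; [_,_]′)
import Data.Sum as Sum
open import Data.Empty using (⊥; ⊥-elim)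
open import Function using (_∘_)
open import Relation.Nullary using (Dec; yes; no)
open import Relation.Binary.PropositionalEquality

module Periodic {A : Set} (f : ℕ → A) (N : ℕ) (periodic : ∀ i → f (i + N) ≡ f i) where

  periodic-* : ∀ q i → f (i + q * N) ≡ f i
  periodic-* zero    i = cong f (+-identityʳ i)
  periodic-* (suc q) i = begin
    f (i + (N + q * N)) ≡⟨ cong f (cong (i +_) (+-comm N (q * N))) ⟩
    f (i + (q * N + N)) ≡⟨ cong f (sym (+-assoc i (q * N) N)) ⟩
    f (i + q * N + N)   ≡⟨ periodic (i + q * N) ⟩
    f (i + q * N)       ≡⟨ periodic-* q i ⟩
    f i                 ∎
    where open ≡-Reasoning

  periodic-% : .{{_ : NonZero N}} → ∀ i m → f (i + m) ≡ f (i % N + m)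
  periodic-% i m = begin
    f (i + m)                     ≡⟨ cong (λ j → f (j + m)) (m≡m%n+[m/n]*n i N) ⟩
    f (i % N + i / N * N + m)     ≡⟨ cong f (xy∙z≈xz∙y (i % N) (i / N * N) m) ⟩
    f (i % N + m + i / N * N)     ≡⟨ periodic-* (i / N) (i % N + m) ⟩
    f (i % N + m)                 ∎
    where open ≡-Reasoning

  no-return : (∀ i j → i < N → j < N → f i ≡ f j → i ≡ j) →
              ∀ i {m} → 0 < m → m < N → f i ≢ f (i + m)
  no-return injective i {m} 0<m m<N fi≡fi+m = within-period (r + m <? N)
    where
    instance
      N≢0 : NonZero N
      N≢0 = >-nonZero (<-trans 0<m m<N)
    r = i % N
    r<N : r < N
    r<N = m%n<n i N
    fr≡fr+m : f r ≡ f (r + m)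
    fr≡fr+m = begin
      f r       ≡⟨ cong f (sym (+-identityʳ r)) ⟩
      f (r + 0) ≡⟨ periodic-% i 0 ⟨
      f (i + 0) ≡⟨ cong f (+-identityʳ i) ⟩
      f i       ≡⟨ fi≡fi+m ⟩
      f (i + m) ≡⟨ periodic-% i m ⟩
      f (r + m) ∎
      where open ≡-Reasoning
    within-period : Dec (r + m < N) → ⊥
    within-period (yes r+m<N) =
      <-irrefl (injective r (r + m) r<N r+m<N fr≡fr+m) (m<m+n r 0<m)
    within-period (no r+m≮N) = <-irrefl (sym (injective r s r<N s<N fr≡fs)) s<r
      where
      s = r + m ∸ N
      s+N≡r+m : s + N ≡ r + m
      s+N≡r+m = m∸n+n≡m (≮⇒≥ r+m≮N)
      s<r : s < r
      s<r = +-cancelʳ-< N s r (subst (_< r + N) (sym s+N≡r+m) (+-monoʳ-< r m<N))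
      s<N : s < N
      s<N = <-trans s<r r<N
      fr≡fs : f r ≡ f s
      fr≡fs = trans fr≡fr+m (trans (cong f (sym s+N≡r+m)) (periodic s))

crossing : {Q R : ℕ → Set} → (∀ i → Q i ⊎ R i) →
           ∀ {j} d → .{{NonZero d}} → Q j → R (j + d) → ∃[ i ] Q i × R (suc i)
crossing {R = R} _ {j} 1 q r = j , q , subst R (+-comm j 1) r
crossing {R = R} Q⊎R {j} (suc (suc d)) q r =
  [ (λ q' → crossing Q⊎R (suc d) q' (subst R (+-suc j (suc d)) r)) , (λ r' → j , q , r') ]′
    (Q⊎R (suc j))

_<₁₂_ : Triple → Triple → Set
(a , b , _) <₁₂ (a' , b' , _) = a < a' × b < b'

<₂-equal₁ : ∀ {a b c b' c'} → (a , b , c) <₂ (a , b' , c') → b < b' × c < c'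
<₂-equal₁ (inj₁ (a<a , _))       = ⊥-elim (<-irrefl refl a<a)
<₂-equal₁ (inj₂ (inj₁ (a<a , _))) = ⊥-elim (<-irrefl refl a<a)
<₂-equal₁ (inj₂ (inj₂ b<b'∧c<c')) = b<b'∧c<c'

<₂-equal₂ : ∀ {a b c a' c'} → (a , b , c) <₂ (a' , b , c') → a < a' × c < c'
<₂-equal₂ (inj₁ (_ , b<b))        = ⊥-elim (<-irrefl refl b<b)
<₂-equal₂ (inj₂ (inj₁ a<a'∧c<c')) = a<a'∧c<c'
<₂-equal₂ (inj₂ (inj₂ (b<b , _))) = ⊥-elim (<-irrefl refl b<b)

<₂-equal₃ : ∀ {a b c a' b'} → (a , b , c) <₂ (a' , b' , c) → (a , b , c) <₁₂ (a' , b' , c)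
<₂-equal₃ (inj₁ a<a'∧b<b')        = a<a'∧b<b'
<₂-equal₃ (inj₂ (inj₁ (_ , c<c))) = ⊥-elim (<-irrefl refl c<c)
<₂-equal₃ (inj₂ (inj₂ (_ , c<c))) = ⊥-elim (<-irrefl refl c<c)

Step : Triple → Triple → Set
Step (a , b , c) (a' , b' , c') =
  a ≡ a' × (b < b' × c < c' ⊎ b' < b × c' < c) ⊎
  b ≡ b' × (a < a' × c < c' ⊎ a' < a × c' < c)

label : Triple → ℕ
label (_ , _ , c) = c

-- If the shared coordinates are the same, they close a strict cycle in that coordinate.
-- Otherwise the equal labels make the two steps go in the same direction, and the
-- coordinate shared by one step closes a strict cycle through the other.
steps-do-not-cross : ∀ x y x' y' → Step x y → Step x' y' → label x ≡ label x' →
                     label y ≡ label y' → x <₁₂ x' → ¬ y' <₁₂ y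
steps-do-not-cross (a , b , c) (a₁ , b₁ , d) (a' , b' , _) (a₂ , b₂ , _) st st' refl refl
                   (a<a' , b<b') (a₂<a₁ , b₂<b₁) with st | st'
... | inj₁ (refl , _) | inj₁ (refl , _) = <-asym a<a' a₂<a₁
... | inj₂ (refl , _) | inj₂ (refl , _) = <-asym b<b' b₂<b₁
... | inj₁ (refl , _) | inj₂ (refl , inj₁ (a'<a₂ , _)) =
  <-irrefl refl (<-trans a<a' (<-trans a'<a₂ a₂<a₁))
... | inj₁ (refl , inj₁ (_ , c<d)) | inj₂ (refl , inj₂ (_ , d<c)) = <-asym c<d d<c
... | inj₁ (refl , inj₂ (b₁<b , _)) | inj₂ (refl , inj₂ _) =
  <-irrefl refl (<-trans b<b' (<-trans b₂<b₁ b₁<b))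
... | inj₂ (refl , _) | inj₁ (refl , inj₁ (b'<b₂ , _)) =
  <-irrefl refl (<-trans b<b' (<-trans b'<b₂ b₂<b₁))
... | inj₂ (refl , inj₁ (_ , c<d)) | inj₁ (refl , inj₂ (_ , d<c)) = <-asym c<d d<c
... | inj₂ (refl , inj₂ (a₁<a , _)) | inj₁ (refl , inj₂ _) =
  <-irrefl refl (<-trans a<a' (<-trans a₂<a₁ a₁<a))

-- Pairs of vertices on the same side are never edges; they get the junk triple (0 , 0 , c).
edgeTriple : Vertex → Vertex → ℕ → Triple
edgeTriple (inj₁ a) (inj₂ b) c = a , b , c
edgeTriple (inj₂ b) (inj₁ a) c = a , b , c
edgeTriple (inj₁ _) (inj₁ _) c = 0 , 0 , c
edgeTriple (inj₂ _) (inj₂ _) c = 0 , 0 , c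

label-edgeTriple : ∀ u w c → label (edgeTriple u w c) ≡ c
label-edgeTriple (inj₁ _) (inj₂ _) c = refl
label-edgeTriple (inj₂ _) (inj₁ _) c = refl
label-edgeTriple (inj₁ _) (inj₁ _) c = refl
label-edgeTriple (inj₂ _) (inj₂ _) c = refl

module _ (T : TripleSet) where

  edgeTriple∈T : ∀ {u w c} → Edge T u w c → T (edgeTriple u w c)
  edgeTriple∈T {inj₁ _} {inj₂ _} uw = uw
  edgeTriple∈T {inj₂ _} {inj₁ _} uw = uw

  edgeTriple-injective : ∀ {u w c u' w' c'} → Edge T u w c → Edge T u' w' c' →
                         edgeTriple u w c ≡ edgeTriple u' w' c' → u ≡ u' ⊎ u ≡ w'
  edgeTriple-injective {inj₁ _} {inj₂ _} {u' = inj₁ _} {inj₂ _} _ _ refl = inj₁ refl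
  edgeTriple-injective {inj₁ _} {inj₂ _} {u' = inj₂ _} {inj₁ _} _ _ refl = inj₂ refl
  edgeTriple-injective {inj₂ _} {inj₁ _} {u' = inj₁ _} {inj₂ _} _ _ refl = inj₂ refl
  edgeTriple-injective {inj₂ _} {inj₁ _} {u' = inj₂ _} {inj₁ _} _ _ refl = inj₁ refl
  edgeTriple-injective {inj₁ _} {inj₁ _} () _ _
  edgeTriple-injective {inj₂ _} {inj₂ _} () _ _
  edgeTriple-injective {inj₁ _} {inj₂ _} {u' = inj₁ _} {inj₁ _} _ () _
  edgeTriple-injective {inj₁ _} {inj₂ _} {u' = inj₂ _} {inj₂ _} _ () _
  edgeTriple-injective {inj₂ _} {inj₁ _} {u' = inj₁ _} {inj₁ _} _ () _
  edgeTriple-injective {inj₂ _} {inj₁ _} {u' = inj₂ _} {inj₂ _} _ () _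

  module _ (comparable : TwoComparable T) where

    consecutive-edges-step : ∀ {u w z c c'} → Edge T u w c → Edge T w z c' → u ≢ z →
                             Step (edgeTriple u w c) (edgeTriple w z c')
    consecutive-edges-step {inj₁ a} {inj₂ b} {inj₁ a'} {c} {c'} uw wz u≢z =
      inj₂ (refl , Sum.map <₂-equal₂ <₂-equal₂
        (comparable (a , b , c) (a' , b , c') uw wz λ { refl → u≢z refl }))
    consecutive-edges-step {inj₂ b} {inj₁ a} {inj₂ b'} {c} {c'} uw wz u≢z =
      inj₁ (refl , Sum.map <₂-equal₁ <₂-equal₁
        (comparable (a , b , c) (a , b' , c') uw wz λ { refl → u≢z refl }))
    consecutive-edges-step {inj₁ _} {inj₁ _} () _ _
    consecutive-edges-step {inj₂ _} {inj₂ _} () _ _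
    consecutive-edges-step {inj₁ _} {inj₂ _} {inj₂ _} _ () _
    consecutive-edges-step {inj₂ _} {inj₁ _} {inj₁ _} _ () _

    same-label-comparable : ∀ x y → T x → T y → x ≢ y → label x ≡ label y →
                            x <₁₂ y ⊎ y <₁₂ x
    same-label-comparable (a , b , c) (a' , b' , .c) x∈T y∈T x≢y refl =
      Sum.map <₂-equal₃ <₂-equal₃ (comparable _ _ x∈T y∈T x≢y)

module RepeatingCycleContradiction
  (T : TripleSet) (comparable : TwoComparable T)
  (k : ℕ) (2≤k : 2 ≤ k) (v : ℕ → Vertex) (l : ℕ → ℕ)
  (v-periodic : ∀ i → v (i + 2 * k) ≡ v i)
  (v-injective : ∀ i j → i < 2 * k → j < 2 * k → v i ≡ v j → i ≡ j)
  (edge : ∀ i → Edge T (v i) (v (suc i)) (l i))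
  (l-repeats : ∀ i → l (i + k) ≡ l i) where

  0<k : 0 < k
  0<k = <-≤-trans z<s 2≤k

  instance
    k≢0 : NonZero k
    k≢0 = >-nonZero 0<k

  1+k<2k : suc k < 2 * k
  1+k<2k = subst (suc k <_) (cong (k +_) (sym (+-identityʳ k))) (+-monoˡ-≤ k 2≤k)

  v-no-return : ∀ i {m} → 0 < m → m < 2 * k → v i ≢ v (i + m)
  v-no-return = Periodic.no-return v (2 * k) v-periodic v-injective

  i+k+k≡i+2k : ∀ i → i + k + k ≡ i + 2 * k
  i+k+k≡i+2k i = trans (+-assoc i k k) (cong (λ m → i + (k + m)) (sym (+-identityʳ k)))

  e : ℕ → Triple
  e i = edgeTriple (v i) (v (suc i)) (l i)

  e-periodic : ∀ i → e (i + k + k) ≡ e i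
  e-periodic i = trans
    (cong₂ (λ u w → edgeTriple u w (l (i + k + k)))
      (trans (cong v (i+k+k≡i+2k i)) (v-periodic i))
      (trans (cong v (cong suc (i+k+k≡i+2k i))) (v-periodic (suc i))))
    (cong (edgeTriple (v i) (v (suc i))) (trans (l-repeats (i + k)) (l-repeats i)))

  label-e : ∀ i → label (e i) ≡ l i
  label-e i = label-edgeTriple (v i) (v (suc i)) (l i)

  label-e-repeats : ∀ i → label (e i) ≡ label (e (i + k))
  label-e-repeats i = trans (label-e i) (trans (sym (l-repeats i)) (sym (label-e (i + k))))

  e-step : ∀ i → Step (e i) (e (suc i))
  e-step i = consecutive-edges-step T comparable (edge i) (edge (suc i))
    λ vi≡v2+i → v-no-return i z<s (<-trans (s≤s 2≤k) 1+k<2k)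
                  (trans vi≡v2+i (cong v (+-comm 2 i)))

  e-distinct : ∀ i → e i ≢ e (i + k)
  e-distinct i ei≡ei+k with edgeTriple-injective T (edge i) (edge (i + k)) ei≡ei+k
  ... | inj₁ vi≡vi+k   = v-no-return i 0<k (<-trans (n<1+n k) 1+k<2k) vi≡vi+k
  ... | inj₂ vi≡v1+i+k = v-no-return i z<s 1+k<2k (trans vi≡v1+i+k (cong v (sym (+-suc i k))))

  Ahead Behind : ℕ → Set
  Ahead  i = e i <₁₂ e (i + k)
  Behind i = e (i + k) <₁₂ e i

  ahead-or-behind : ∀ i → Ahead i ⊎ Behind i
  ahead-or-behind i = same-label-comparable T comparable (e i) (e (i + k))
    (edgeTriple∈T T (edge i)) (edgeTriple∈T T (edge (i + k))) (e-distinct i) (label-e-repeats i)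

  ahead⇒behind : ∀ i → Ahead i → Behind (i + k)
  ahead⇒behind i = subst (_<₁₂ e (i + k)) (sym (e-periodic i))

  behind⇒ahead : ∀ i → Behind i → Ahead (i + k)
  behind⇒ahead i = subst (e (i + k) <₁₂_) (sym (e-periodic i))

  never-ahead : ∀ j → ¬ Ahead j
  never-ahead j ahead with crossing ahead-or-behind k ahead (ahead⇒behind j ahead)
  ... | i , ahead-i , behind-1+i =
    steps-do-not-cross (e i) (e (suc i)) (e (i + k)) (e (suc i + k))
      (e-step i) (e-step (i + k)) (label-e-repeats i) (label-e-repeats (suc i))
      ahead-i behind-1+i

  absurd : ⊥
  absurd = [ never-ahead 0 , never-ahead k ∘ behind⇒ahead 0 ]′ (ahead-or-behind 0)

proposition4p5 : (n : ℕ) → 1 ≤ n → (T : TripleSet) →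
    (∀ t → T t → InCube n t) → TwoComparable T → ¬ RepeatingCycle T
-- The bound n on the entries plays no role.
proposition4p5 _ _ T _ comparable (k , 2≤k , v , l , v-periodic , v-injective , edge , l-repeats) =
  RepeatingCycleContradiction.absurd T comparable k 2≤k v l v-periodic v-injective edge l-repeats
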